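{- Let $\alpha,\beta$ be relatively prime positive integers, and let $(b,a)$ be an $n$-good pair where $s=s(n)>2$. Then: (a) $a-\alpha b-\ell g_s$ is not a positive multiple of $\beta$ for any integer $\ell\ge0$; (b) a pair $(b',a')$ is $n$-good if and only if there exists $k\in\mathbb{Z}$ such that $a'=a+k\beta g_{s-2}\ge1$ and $b'=b-k g_{s-1}\ge1$; (c) with $a',b',k$ as in (b), $w_{s+1}(b',a')-w_{s+1}(b,a)=k(-\beta)^{s-1}$.
   Context: For positive integers $a_1,a_2$, the $(\alpha,\beta)$-walk $w_k(a_1,a_2)$ is the sequence with $w_1=a_1$, $w_2=a_2$, $w_{k+2}=\alpha w_{k+1}+\beta w_k$ for $k\ge1$. For a positive integer $n$, $s(n;a_1,a_2)$ is the (largest) index $s$ with $w_s(a_1,a_2)=n$ ($-\infty$ if none), and $s(n)=\max_{a_1,a_2\ge1}s(n;a_1,a_2)$. A pair $(a_1,a_2)$ is $n$-good if $a_1,a_2\ge1$ and $s(n;a_1,a_2)=s(n)$. The sequence $g_k$ is defined by $g_1=1$, $g_2=\alpha$, $g_{k+2}=\alpha g_{k+1}+\beta g_k$ for $k\ge1$. -}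

module Defs where

open import Data.Nat using (ℕ; zero; suc; _+_; _*_; _∸_; _≤_)
open import Data.Product using (Σ; ∃; _×_)
open import Relation.Binary.PropositionalEquality using (_≡_)

u : (α β a₁ a₂ : ℕ) → ℕ → ℕ
u α β a₁ a₂ zero = a₁
u α β a₁ a₂ (suc zero) = a₂
u α β a₁ a₂ (suc (suc k)) = α * u α β a₁ a₂ (suc k) + β * u α β a₁ a₂ k

-- the (α,β)-walk, 1-indexed as in the paper: w k a₁ a₂ = w_k(a₁,a₂) for k ≥ 1
w : (α β : ℕ) → ℕ → (a₁ a₂ : ℕ) → ℕ
w α β k a₁ a₂ = u α β a₁ a₂ (k ∸ 1)

g : (α β : ℕ) → ℕ → ℕ
g α β k = w α β k 1 α

IsS : (α β n s : ℕ) → Set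
IsS α β n s =
  (∃ λ a₁ → ∃ λ a₂ → 1 ≤ a₁ × 1 ≤ a₂ × w α β s a₁ a₂ ≡ n)
  × (∀ a₁ a₂ t → 1 ≤ a₁ → 1 ≤ a₂ → 1 ≤ t → w α β t a₁ a₂ ≡ n → t ≤ s)

-- (a₁,a₂) is n-good: positive and s(n;a₁,a₂) = s(n)
Good : (α β n a₁ a₂ : ℕ) → Set
Good α β n a₁ a₂ = ∃ λ s → IsS α β n s × 1 ≤ a₁ × 1 ≤ a₂ × w α β s a₁ a₂ ≡ n

{-# OPTIONS --safe #-}
-- With g₀ = 0, every walk satisfies w_{j+2}(x, y) = g_{j+1} y + β g_j x.
-- (a) If a − αb − ℓ g_s = mβ with m ≥ 1, the walk from (m, b + ℓ g_{s−1})
-- has w_{s+1} = w_s(b, a) = n, contradicting the maximality of s.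
-- (b) The good pairs are the positive solutions of g_{s−1} y + β g_{s−2} x = n,
-- and g_{s−1} is coprime to β g_{s−2}, so they all lie on the line
-- (b − k g_{s−1}, a + k β g_{s−2}).
-- (c) Along that line w_{s+1} changes by k β (g_s g_{s−2} − g_{s−1}²), which is
-- k (−β)^{s−1} by Cassini's identity for g.
module Submission where

open import Defs
open import Data.Nat using (ℕ; _≤_; _<_; _∸_) renaming (_+_ to _+ℕ_)
open import Data.Nat.Coprimality using (Coprime)
open import Data.Integer using (ℤ; +_; _+_; _-_; _*_; -_; _^_)
open import Data.Product using (∃; _×_)
open import Function.Bundles using (_⇔_)
open import Relation.Binary.PropositionalEquality using (_≡_)
open import Relation.Nullary using (¬_)

open import Data.Nat using (zero; suc; z≤n; s≤s) renaming (_*_ to _*ℕ_)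
open import Data.Integer using (NonZero)
import Data.Nat as ℕ
import Data.Nat.Properties as ℕ
import Data.Nat.Coprimality as ℕ
import Data.Nat.Divisibility as ℕ
import Data.Nat.Tactic.RingSolver as ℕ-Solver
import Data.Integer.Properties as ℤ
import Data.Integer.Coprimality as ℤ
import Data.Integer.Divisibility.Signed as ℤ
import Data.Integer.Tactic.RingSolver as ℤ-Solver
open import Data.List using (_∷_; [])
open import Data.Product using (_,_; proj₁; proj₂; ∃-syntax)
open import Function.Bundles using (mk⇔; Equivalence)
open import Relation.Binary.PropositionalEquality using (refl; sym; trans; cong; cong₂; subst; subst₂; module ≡-Reasoning)

coprime-* : ∀ {m n o} → Coprime m n → Coprime m o → Coprime m (n *ℕ o)
coprime-* {n = n} m⊥n m⊥o (d∣m , d∣no) = m⊥o (d∣m , ℕ.coprime-divisor d⊥n d∣no)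
  where
  d⊥n : Coprime _ n
  d⊥n (e∣d , e∣n) = m⊥n (ℕ.∣-trans e∣d d∣m , e∣n)

coprime-+ˡ : ∀ {m n o} → Coprime m n → m ℕ.∣ o → Coprime m (o +ℕ n)
coprime-+ˡ m⊥n m∣o (d∣m , d∣o+n) = m⊥n (d∣m , ℕ.∣m+n∣m⇒∣n d∣o+n (ℕ.∣-trans d∣m m∣o))

coprime-+ʳ : ∀ {m n o} → Coprime m n → m ℕ.∣ o → Coprime m (n +ℕ o)
coprime-+ʳ {m} {n} {o} m⊥n m∣o = subst (Coprime m) (ℕ.+-comm o n) (coprime-+ˡ m⊥n m∣o)

pos-lincomb : ∀ p y q x → + (p *ℕ y +ℕ q *ℕ x) ≡ + p * + y + + q * + x
pos-lincomb p y q x = trans (ℤ.pos-+ (p *ℕ y) (q *ℕ x)) (cong₂ _+_ (ℤ.pos-* p y) (ℤ.pos-* q x))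

coprime-lincomb-fiber : ∀ (p q : ℤ) .{{_ : NonZero p}} → ℤ.Coprime p q → ∀ {a b a′ b′} →
  p * a′ + q * b′ ≡ p * a + q * b → ∃[ k ] (a′ ≡ a + k * q × b′ ≡ b - k * p)
coprime-lincomb-fiber p q p⊥q {a} {b} {a′} {b′} eq = shift p∣b-b′
  where
  open ≡-Reasoning
  balance : p * (a′ - a) ≡ q * (b - b′)
  balance = begin
    p * (a′ - a)                        ≡⟨ ℤ-Solver.solve (p ∷ q ∷ a ∷ a′ ∷ b′ ∷ []) ⟩
    (p * a′ + q * b′) - q * b′ - p * a  ≡⟨ cong (λ z → z - q * b′ - p * a) eq ⟩
    (p * a + q * b) - q * b′ - p * a    ≡⟨ ℤ-Solver.solve (p ∷ q ∷ a ∷ b ∷ b′ ∷ []) ⟩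
    q * (b - b′)                        ∎
  p∣b-b′ : p ℤ.∣ b - b′
  p∣b-b′ = ℤ.∣ᵤ⇒∣ (ℤ.coprime-divisor p q (b - b′) p⊥q
             (ℤ.∣⇒∣ᵤ (ℤ.divides (a′ - a) (trans (sym balance) (ℤ.*-comm p (a′ - a))))))
  shift : p ℤ.∣ b - b′ → ∃[ k ] (a′ ≡ a + k * q × b′ ≡ b - k * p)
  shift (ℤ.divides k b-b′≡kp) = k , a′≡a+kq , b′≡b-kp
    where
    a′-a≡kq : a′ - a ≡ k * q
    a′-a≡kq = ℤ.*-cancelˡ-≡ p (a′ - a) (k * q) (begin
      p * (a′ - a)  ≡⟨ balance ⟩
      q * (b - b′)  ≡⟨ cong (λ z → q * z) b-b′≡kp ⟩
      q * (k * p)   ≡⟨ ℤ-Solver.solve (p ∷ q ∷ k ∷ []) ⟩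
      p * (k * q)   ∎)
    a′≡a+kq : a′ ≡ a + k * q
    a′≡a+kq = begin
      a′            ≡⟨ ℤ-Solver.solve (a ∷ a′ ∷ []) ⟩
      a + (a′ - a)  ≡⟨ cong (λ z → a + z) a′-a≡kq ⟩
      a + k * q     ∎
    b′≡b-kp : b′ ≡ b - k * p
    b′≡b-kp = begin
      b′              ≡⟨ ℤ-Solver.solve (b ∷ b′ ∷ []) ⟩
      b - (b - b′)    ≡⟨ cong (λ z → b - z) b-b′≡kp ⟩
      b - k * p       ∎

module _ (α β : ℕ) where

  -- The Lucas sequence U(α, −β); it agrees with g α β at every positive index.
  U : ℕ → ℕ
  U zero = 0
  U (suc zero) = 1
  U (suc (suc k)) = α *ℕ U (suc k) +ℕ β *ℕ U k

  w-suc-suc : ∀ j x y → w α β (2 +ℕ j) x y ≡ U (suc j) *ℕ y +ℕ β *ℕ U j *ℕ x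
  w-suc-suc zero x y = base
    where
    base : y ≡ 1 *ℕ y +ℕ β *ℕ 0 *ℕ x
    base = ℕ-Solver.solve (β ∷ x ∷ y ∷ [])
  w-suc-suc (suc zero) x y = base
    where
    base : α *ℕ y +ℕ β *ℕ x ≡ (α *ℕ 1 +ℕ β *ℕ 0) *ℕ y +ℕ β *ℕ 1 *ℕ x
    base = ℕ-Solver.solve (α ∷ β ∷ x ∷ y ∷ [])
  w-suc-suc (suc (suc j)) x y
    rewrite w-suc-suc (suc j) x y | w-suc-suc j x y = step (U (2 +ℕ j)) (U (suc j)) (U j)
    where
    step : ∀ p q r → α *ℕ (p *ℕ y +ℕ β *ℕ q *ℕ x) +ℕ β *ℕ (q *ℕ y +ℕ β *ℕ r *ℕ x)
                   ≡ (α *ℕ p +ℕ β *ℕ q) *ℕ y +ℕ β *ℕ (α *ℕ q +ℕ β *ℕ r) *ℕ x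
    step p q r = ℕ-Solver.solve (α ∷ β ∷ x ∷ y ∷ p ∷ q ∷ r ∷ [])

  g≡U : ∀ j → g α β (suc j) ≡ U (suc j)
  g≡U zero = refl
  g≡U (suc j) = trans (w-suc-suc j 1 α) (swap (U (suc j)) (U j))
    where
    swap : ∀ p q → p *ℕ α +ℕ β *ℕ q *ℕ 1 ≡ α *ℕ p +ℕ β *ℕ q
    swap p q = ℕ-Solver.solve (α ∷ β ∷ p ∷ q ∷ [])

  U-pos : 1 ≤ α → ∀ j → 1 ≤ U (suc j)
  U-pos α≥1 zero = s≤s z≤n
  U-pos α≥1 (suc j) =
    ℕ.≤-trans (ℕ.*-mono-≤ α≥1 (U-pos α≥1 j)) (ℕ.m≤m+n (α *ℕ U (suc j)) (β *ℕ U j))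

  +U-suc-suc : ∀ j → + U (2 +ℕ j) ≡ + α * + U (suc j) + + β * + U j
  +U-suc-suc j = pos-lincomb α (U (suc j)) β (U j)

  +w-suc-suc : ∀ j x y → + w α β (2 +ℕ j) x y ≡ + U (suc j) * + y + + β * + U j * + x
  +w-suc-suc j x y = trans (cong +_ (w-suc-suc j x y))
    (trans (pos-lincomb (U (suc j)) y (β *ℕ U j) x) (cong (λ z → + U (suc j) * + y + z * + x) (ℤ.pos-* β (U j))))

  U-cassini : ∀ j → + U (2 +ℕ j) * + U j - + U (suc j) * + U (suc j) ≡ - ((- (+ β)) ^ j)
  U-cassini zero = base (+ U 2)
    where
    base : ∀ z → z * + 0 - + 1 * + 1 ≡ - (+ 1)
    base = ℤ-Solver.solve-∀
  U-cassini (suc j) = begin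
    + U (3 +ℕ j) * + U (suc j) - + U (2 +ℕ j) * + U (2 +ℕ j)
      ≡⟨ cong₂ (λ z z′ → z * + U (suc j) - + U (2 +ℕ j) * z′) (+U-suc-suc (suc j)) (+U-suc-suc j) ⟩
    (+ α * + U (2 +ℕ j) + + β * + U (suc j)) * + U (suc j) - + U (2 +ℕ j) * (+ α * + U (suc j) + + β * + U j)
      ≡⟨ step (+ α) (+ β) (+ U j) (+ U (suc j)) (+ U (2 +ℕ j)) ⟩
    (- (+ β)) * (+ U (2 +ℕ j) * + U j - + U (suc j) * + U (suc j))
      ≡⟨ cong (λ z → (- (+ β)) * z) (U-cassini j) ⟩
    (- (+ β)) * - ((- (+ β)) ^ j)
      ≡⟨ ℤ.neg-distribʳ-* (- (+ β)) ((- (+ β)) ^ j) ⟨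
    - ((- (+ β)) ^ suc j) ∎
    where
    open ≡-Reasoning
    step : ∀ a b x y z → (a * z + b * y) * y - z * (a * y + b * x) ≡ (- b) * (z * x - y * y)
    step = ℤ-Solver.solve-∀

  w-shift-invariant : ∀ j {a b a′ b′} k → + a′ ≡ + a + k * + β * + U j → + b′ ≡ + b - k * + U (suc j) →
    w α β (2 +ℕ j) b′ a′ ≡ w α β (2 +ℕ j) b a
  w-shift-invariant j {a} {b} {a′} {b′} k a′≡ b′≡ = ℤ.+-injective (begin
    + w α β (2 +ℕ j) b′ a′
      ≡⟨ +w-suc-suc j b′ a′ ⟩
    + U (suc j) * + a′ + + β * + U j * + b′
      ≡⟨ cong₂ (λ z z′ → + U (suc j) * z + + β * + U j * z′) a′≡ b′≡ ⟩
    + U (suc j) * (+ a + k * + β * + U j) + + β * + U j * (+ b - k * + U (suc j))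
      ≡⟨ cancel (+ U (suc j)) (+ U j) (+ β) (+ a) (+ b) k ⟩
    + U (suc j) * + a + + β * + U j * + b
      ≡⟨ +w-suc-suc j b a ⟨
    + w α β (2 +ℕ j) b a ∎)
    where
    open ≡-Reasoning
    cancel : ∀ p q r x y k → p * (x + k * r * q) + r * q * (y - k * p) ≡ p * x + r * q * y
    cancel = ℤ-Solver.solve-∀

  w-shift-next : ∀ j {a b a′ b′} k → + a′ ≡ + a + k * + β * + U j → + b′ ≡ + b - k * + U (suc j) →
    + w α β (3 +ℕ j) b′ a′ - + w α β (3 +ℕ j) b a ≡ k * ((- (+ β)) ^ suc j)
  w-shift-next j {a} {b} {a′} {b′} k a′≡ b′≡ = begin
    + w α β (3 +ℕ j) b′ a′ - + w α β (3 +ℕ j) b a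
      ≡⟨ cong₂ _-_ (+w-suc-suc (suc j) b′ a′) (+w-suc-suc (suc j) b a) ⟩
    (+ U (2 +ℕ j) * + a′ + + β * + U (suc j) * + b′) - (+ U (2 +ℕ j) * + a + + β * + U (suc j) * + b)
      ≡⟨ cong₂ (λ z z′ → (+ U (2 +ℕ j) * z + + β * + U (suc j) * z′) - (+ U (2 +ℕ j) * + a + + β * + U (suc j) * + b)) a′≡ b′≡ ⟩
    (+ U (2 +ℕ j) * (+ a + k * + β * + U j) + + β * + U (suc j) * (+ b - k * + U (suc j)))
      - (+ U (2 +ℕ j) * + a + + β * + U (suc j) * + b)
      ≡⟨ expand (+ U (2 +ℕ j)) (+ U (suc j)) (+ U j) (+ β) (+ a) (+ b) k ⟩
    k * + β * (+ U (2 +ℕ j) * + U j - + U (suc j) * + U (suc j))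
      ≡⟨ cong (λ z → k * + β * z) (U-cassini j) ⟩
    k * + β * - ((- (+ β)) ^ j)
      ≡⟨ regroup k (+ β) ((- (+ β)) ^ j) ⟩
    k * ((- (+ β)) ^ suc j) ∎
    where
    open ≡-Reasoning
    expand : ∀ p q r s x y k → (p * (x + k * s * r) + s * q * (y - k * q)) - (p * x + s * q * y)
                               ≡ k * s * (p * r - q * q)
    expand = ℤ-Solver.solve-∀
    regroup : ∀ k s z → k * s * - z ≡ k * ((- s) * z)
    regroup = ℤ-Solver.solve-∀

  module _ (α⊥β : Coprime α β) where

    coprime-β-U : ∀ j → Coprime β (U (suc j))
    coprime-β-U zero (_ , d∣1) = ℕ.∣1⇒≡1 d∣1
    coprime-β-U (suc j) = coprime-+ʳ (coprime-* (ℕ.sym α⊥β) (coprime-β-U j)) (ℕ.m∣m*n (U j))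

    coprime-U-suc-U : ∀ j → Coprime (U (suc j)) (U j)
    coprime-U-suc-U zero (d∣1 , _) = ℕ.∣1⇒≡1 d∣1
    coprime-U-suc-U (suc j) = ℕ.sym (coprime-+ˡ (coprime-* (ℕ.sym (coprime-β-U j)) (coprime-U-suc-U j)) (ℕ.n∣m*n α))

    coprime-U-βU : ∀ j → Coprime (U (suc j)) (β *ℕ U j)
    coprime-U-βU j = coprime-* (ℕ.sym (coprime-β-U j)) (coprime-U-suc-U j)

    w-fiber : 1 ≤ α → ∀ j {a b a′ b′} → w α β (2 +ℕ j) b′ a′ ≡ w α β (2 +ℕ j) b a →
      ∃[ k ] (+ a′ ≡ + a + k * + β * + U j × + b′ ≡ + b - k * + U (suc j))
    w-fiber α≥1 j {a} {b} {a′} {b′} eq = reassociate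
      (coprime-lincomb-fiber (+ U (suc j)) (+ β * + U j) {{ℕ.>-nonZero (U-pos α≥1 j)}}
        (subst (Coprime (U (suc j))) (sym (ℤ.abs-* (+ β) (+ U j))) (coprime-U-βU j))
        (trans (sym (+w-suc-suc j b′ a′)) (trans (cong +_ eq) (+w-suc-suc j b a))))
      where
      reassociate : ∃[ k ] (+ a′ ≡ + a + k * (+ β * + U j) × + b′ ≡ + b - k * + U (suc j)) →
                    ∃[ k ] (+ a′ ≡ + a + k * + β * + U j × + b′ ≡ + b - k * + U (suc j))
      reassociate (k , a′≡ , b′≡) = k , trans a′≡ (cong (λ z → + a + z) (sym (ℤ.*-assoc k (+ β) (+ U j)))) , b′≡

  IsS-positive : ∀ {n s} → IsS α β n s → 1 ≤ s
  -- The index-0 term of a walk is its index-1 term, as 0 ∸ 1 = 0.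
  IsS-positive {s = zero} ((x , y , x≥1 , y≥1 , hit) , maximal) = maximal x y 1 x≥1 y≥1 ℕ.≤-refl hit
  IsS-positive {s = suc s} _ = s≤s z≤n

  IsS-unique : ∀ {n s s′} → IsS α β n s → IsS α β n s′ → s ≡ s′
  IsS-unique isS isS′ = ℕ.≤-antisym (bound isS′ isS) (bound isS isS′)
    where
    bound : ∀ {n s s′} → IsS α β n s → IsS α β n s′ → s′ ≤ s
    bound (_ , maximal) isS′@((x , y , x≥1 , y≥1 , hit) , _) = maximal x y _ x≥1 y≥1 (IsS-positive isS′) hit

  good⇔ : ∀ {n s x y} → IsS α β n s → Good α β n x y ⇔ (1 ≤ x × 1 ≤ y × w α β s x y ≡ n)
  good⇔ {n} {x = x} {y} isS = mk⇔
    (λ (s′ , isS′ , x≥1 , y≥1 , hit) → x≥1 , y≥1 , subst (λ r → w α β r x y ≡ n) (IsS-unique isS′ isS) hit)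
    (λ (x≥1 , y≥1 , hit) → _ , isS , x≥1 , y≥1 , hit)

  w-prepend : ∀ j m b ℓ →
    w α β (3 +ℕ j) m (b +ℕ ℓ *ℕ U (suc j)) ≡ w α β (2 +ℕ j) b (α *ℕ b +ℕ ℓ *ℕ U (2 +ℕ j) +ℕ m *ℕ β)
  w-prepend j m b ℓ = trans (w-suc-suc (suc j) m _)
    (trans (regroup (U (suc j)) (U j)) (sym (w-suc-suc j b _)))
    where
    regroup : ∀ p q → (α *ℕ p +ℕ β *ℕ q) *ℕ (b +ℕ ℓ *ℕ p) +ℕ β *ℕ p *ℕ m
                    ≡ p *ℕ (α *ℕ b +ℕ ℓ *ℕ (α *ℕ p +ℕ β *ℕ q) +ℕ m *ℕ β) +ℕ β *ℕ q *ℕ b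
    regroup p q = ℕ-Solver.solve (α ∷ β ∷ m ∷ b ∷ ℓ ∷ p ∷ q ∷ [])

  no-longer-walk : ∀ {n j b a} → IsS α β n (2 +ℕ j) → Good α β n b a →
    ∀ ℓ m → 1 ≤ m → ¬ (+ a - + α * + b - + ℓ * + U (2 +ℕ j) ≡ + m * + β)
  no-longer-walk {n} {j} {b} {a} isS@(_ , maximal) good ℓ m m≥1 eq =
    ℕ.1+n≰n (maximal m (b +ℕ ℓ *ℕ U (suc j)) (3 +ℕ j) m≥1 (ℕ.≤-trans b≥1 (ℕ.m≤m+n b _)) (s≤s z≤n)
      (trans (w-prepend j m b ℓ) (subst (λ z → w α β (2 +ℕ j) b z ≡ n) a≡ hit)))
    where
    open ≡-Reasoning
    b≥1 : 1 ≤ b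
    b≥1 = proj₁ (Equivalence.to (good⇔ isS) good)
    hit : w α β (2 +ℕ j) b a ≡ n
    hit = proj₂ (proj₂ (Equivalence.to (good⇔ isS) good))
    regroup : ∀ x y z → x ≡ y + z + (x - y - z)
    regroup = ℤ-Solver.solve-∀
    a≡ : a ≡ α *ℕ b +ℕ ℓ *ℕ U (2 +ℕ j) +ℕ m *ℕ β
    a≡ = ℤ.+-injective (begin
      + a
        ≡⟨ regroup (+ a) (+ α * + b) (+ ℓ * + U (2 +ℕ j)) ⟩
      + α * + b + + ℓ * + U (2 +ℕ j) + (+ a - + α * + b - + ℓ * + U (2 +ℕ j))
        ≡⟨ cong (λ z → + α * + b + + ℓ * + U (2 +ℕ j) + z) eq ⟩
      + α * + b + + ℓ * + U (2 +ℕ j) + + m * + β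
        ≡⟨ cong₂ _+_ (pos-lincomb α b ℓ (U (2 +ℕ j))) (ℤ.pos-* m β) ⟨
      + (α *ℕ b +ℕ ℓ *ℕ U (2 +ℕ j)) + + (m *ℕ β)
        ≡⟨ ℤ.pos-+ (α *ℕ b +ℕ ℓ *ℕ U (2 +ℕ j)) (m *ℕ β) ⟨
      + (α *ℕ b +ℕ ℓ *ℕ U (2 +ℕ j) +ℕ m *ℕ β) ∎)

  good-pairs : 1 ≤ α → Coprime α β → ∀ {n j b a} → IsS α β n (2 +ℕ j) → Good α β n b a →
    ∀ b′ a′ → Good α β n b′ a′ ⇔
      (∃[ k ] (+ a′ ≡ + a + k * + β * + U j × 1 ≤ a′ × + b′ ≡ + b - k * + U (suc j) × 1 ≤ b′))
  good-pairs α≥1 α⊥β {n} {j} {b} {a} isS good b′ a′ = mk⇔ to from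
    where
    hit : w α β (2 +ℕ j) b a ≡ n
    hit = proj₂ (proj₂ (Equivalence.to (good⇔ isS) good))
    to : Good α β n b′ a′ →
         ∃[ k ] (+ a′ ≡ + a + k * + β * + U j × 1 ≤ a′ × + b′ ≡ + b - k * + U (suc j) × 1 ≤ b′)
    to good′ =
      let b′≥1 , a′≥1 , hit′ = Equivalence.to (good⇔ isS) good′
          k , a′≡ , b′≡ = w-fiber α⊥β α≥1 j (trans hit′ (sym hit))
      in k , a′≡ , a′≥1 , b′≡ , b′≥1
    from : ∃[ k ] (+ a′ ≡ + a + k * + β * + U j × 1 ≤ a′ × + b′ ≡ + b - k * + U (suc j) × 1 ≤ b′) →
           Good α β n b′ a′
    from (k , a′≡ , a′≥1 , b′≡ , b′≥1) =
      Equivalence.from (good⇔ isS) (b′≥1 , a′≥1 , trans (w-shift-invariant j k a′≡ b′≡) hit)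

lemma3 : (α β : ℕ) → 1 ≤ α → 1 ≤ β → Coprime α β →
    (n s b a : ℕ) → IsS α β n s → 2 < s → Good α β n b a →
    (∀ (ℓ : ℕ) → ¬ (∃ λ (m : ℕ) → 1 ≤ m ×
        ((+ a) - (+ α) * (+ b) - (+ ℓ) * (+ g α β s)) ≡ (+ m) * (+ β)))
    × (∀ (b′ a′ : ℕ) → Good α β n b′ a′ ⇔
        (∃ λ (k : ℤ) → (+ a′) ≡ (+ a) + k * (+ β) * (+ g α β (s ∸ 2)) × 1 ≤ a′
                     × (+ b′) ≡ (+ b) - k * (+ g α β (s ∸ 1)) × 1 ≤ b′))
    × (∀ (b′ a′ : ℕ) (k : ℤ) →
        (+ a′) ≡ (+ a) + k * (+ β) * (+ g α β (s ∸ 2)) → 1 ≤ a′ →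
        (+ b′) ≡ (+ b) - k * (+ g α β (s ∸ 1)) → 1 ≤ b′ →
        (+ w α β (1 +ℕ s) b′ a′) - (+ w α β (1 +ℕ s) b a) ≡ k * ((- (+ β)) ^ (s ∸ 1)))
lemma3 α β α≥1 _ α⊥β n (suc (suc (suc t))) b a isS (s≤s (s≤s (s≤s _))) good =
    (λ ℓ (m , m≥1 , eq) → no-longer-walk α β isS good ℓ m m≥1
      (subst (λ G → + a - + α * + b - + ℓ * + G ≡ + m * + β) (g≡U α β (2 +ℕ t)) eq))
  , (λ b′ a′ → subst₂ (λ G₁ G₂ → Good α β n b′ a′ ⇔
                         (∃[ k ] (+ a′ ≡ + a + k * + β * + G₁ × 1 ≤ a′ × + b′ ≡ + b - k * + G₂ × 1 ≤ b′)))
                 (sym (g≡U α β t)) (sym (g≡U α β (suc t))) (good-pairs α β α≥1 α⊥β isS good b′ a′))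
  , λ b′ a′ k a′≡ _ b′≡ _ → w-shift-next α β (suc t) k
      (subst (λ G → + a′ ≡ + a + k * + β * + G) (g≡U α β t) a′≡)
      (subst (λ G → + b′ ≡ + b - k * + G) (g≡U α β (suc t)) b′≡)
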